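{- $R(B_{4,4},S_4)=9$.
   Context: For graphs $G_1,G_2$, $R(G_1,G_2)$ is the least integer $N$ such that every red/blue edge-coloring of $K_N$ contains a red copy of $G_1$ or a blue copy of $G_2$. $S_4$ denotes the star with $4$ edges ($5$ vertices). $B_{4,4}$ denotes the bistar on $8$ vertices: two adjacent vertices each of degree $4$, and $6$ further vertices of degree $1$. -}

module Defs where

open import Data.Nat using (ℕ; zero; suc; _<_)
open import Data.Fin using (Fin; toℕ)
open import Data.Bool using (Bool; true; false)
open import Data.Product using (_×_; _,_; Σ-syntax)
open import Data.Sum using (_⊎_)
open import Data.List using (List; []; _∷_)
open import Data.List.Membership.Propositional using (_∈_)
open import Relation.Nullary using (¬_)
open import Relation.Binary.PropositionalEquality using (_≡_; _≢_)
open import Function.Definitions using (Injective)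

record Graph : Set₁ where
  field
    n   : ℕ
    Adj : Fin n → Fin n → Set

open Graph public

fromEdges : ℕ → List (ℕ × ℕ) → Graph
fromEdges k es = record
  { n = k
  ; Adj = λ i j → ((toℕ i , toℕ j) ∈ es) ⊎ ((toℕ j , toℕ i) ∈ es) }

Star : ℕ → Graph
Star k = record
  { n = suc k
  ; Adj = λ i j → (toℕ i ≡ 0 × toℕ j ≢ 0) ⊎ (toℕ j ≡ 0 × toℕ i ≢ 0) }

B44 : Graph
B44 = fromEdges 8
  ( (0 , 1) ∷ (0 , 2) ∷ (0 , 3) ∷ (0 , 4) ∷ (1 , 5) ∷ (1 , 6) ∷ (1 , 7) ∷ [])

-- A red/blue edge-colouring of K_N: a symmetric map on pairs of vertices
-- (true = red, false = blue); values on the diagonal are irrelevant.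
Colouring : ℕ → Set
Colouring N = Fin N → Fin N → Bool

Symmetric : ∀ {N} → Colouring N → Set
Symmetric c = ∀ x y → c x y ≡ c y x

HasCopy : ∀ {N} → Colouring N → Bool → Graph → Set
HasCopy {N} c col G =
  Σ[ f ∈ (Fin (n G) → Fin N) ]
    (Injective _≡_ _≡_ f × (∀ i j → Adj G i j → c (f i) (f j) ≡ col))

Arrows : ℕ → Graph → Graph → Set
Arrows N G₁ G₂ = (c : Colouring N) → Symmetric c →
  HasCopy c true G₁ ⊎ HasCopy c false G₂

IsRamseyNumber : Graph → Graph → ℕ → Set
IsRamseyNumber G₁ G₂ N = Arrows N G₁ G₂ × (∀ M → M < N → ¬ Arrows M G₁ G₂)

module Submission where

-- Upper bound.  In a colouring of K₉ with no blue S₄ every blue degree is ≤ 3,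
-- so every red degree is ≥ 5.  Double counting the pairs (v , w) with v red
-- to 0 and w blue to both 0 and v (≥ 5·2 pairs if each v had two such w, but
-- ≤ 3·2 since each blue neighbour of 0 has ≤ 2 further blue neighbours) gives
-- a red neighbour v of 0 with at most one common blue neighbour.  Then
-- A = N_red(0) ∖ v and B = N_red(v) ∖ 0 satisfy |A|, |B| ≥ 3 and |A ∪ B| ≥ 6,
-- and Hall's theorem for two sets yields a red B₄,₄ with centres 0 and v.
-- Lower bound.  On ≤ 7 vertices colour everything red.  On 8 vertices colour
-- the 3-regular Wagner graph (x ~ x ± 1, x + 4 mod 8) blue: red-adjacent
-- vertices have a common blue neighbour, which a red B₄,₄ (spanning all 8
-- vertices, each red to a centre) cannot accommodate.

open import Defs

open import Data.Nat using (ℕ; zero; suc; _+_; _*_; _≤_; _<_; z≤n; s≤s; _≤?_)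
open import Data.Nat.Properties
  using ( ≤-refl; ≤-reflexive; ≤-trans; ≤-pred; module ≤-Reasoning; m≤n+m; +-mono-≤; +-monoʳ-≤
        ; +-cancelʳ-≤; *-monoˡ-≤; <⇒≱; ≰⇒>; n≤0⇒n≡0; 1+n≰n; m≤n⇒m<n∨m≡n
        ; +-commutativeSemigroup; +-0-commutativeMonoid )
open import Algebra.Properties.CommutativeSemigroup +-commutativeSemigroup using (x∙yz≈y∙xz)
open import Algebra.Properties.CommutativeMonoid.Sum +-0-commutativeMonoid
  using (sum; sum-cong-≗; ∑-distrib-+; ∑-comm)
open import Data.Bool using (Bool; true; false; _∧_; _∨_; not)
import Data.Bool.Properties as Bool
open import Data.Fin using (Fin; zero; suc; toℕ; fromℕ<; punchOut; _↑ˡ_; _↑ʳ_; splitAt; join)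
open import Data.Fin.Patterns using (0F; 1F; 2F; 3F; 4F; 5F; 6F; 7F)
open import Data.Fin.Properties
  using (_≟_; any?; all?; suc-injective; toℕ-injective; injective⇒≤; punchOut-injective; join-splitAt)
open import Data.Nat.DivMod using (m%n<n)
open import Data.Vec.Functional using (_∷_)
open import Data.List using (List; []) renaming (_∷_ to _∷ᴸ_)
open import Data.List.Membership.Propositional using (_∈_)
open import Data.List.Relation.Unary.Any using (here; there)
open import Data.Product using (Σ; ∃; _×_; _,_; proj₁; proj₂)
open import Data.Sum using (_⊎_; inj₁; inj₂; [_,_])
open import Data.Empty using (⊥; ⊥-elim)
open import Function using (_∘_)
open import Function.Definitions using (Injective)
open import Relation.Nullary using (¬_; yes; no; does)
open import Relation.Nullary.Decidable using (dec-false; from-yes; ¬?; _×-dec_; _→-dec_)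
open import Relation.Binary.PropositionalEquality
  using (_≡_; _≢_; refl; sym; trans; cong; cong₂; subst; module ≡-Reasoning)

⟦_⟧ : Bool → ℕ
⟦ true ⟧  = 1
⟦ false ⟧ = 0

count : ∀ {n} → (Fin n → Bool) → ℕ
count P = sum (λ x → ⟦ P x ⟧)

infixl 6 _∖_
infixr 5 _∪_
infixr 6 _∩_

_∖_ : ∀ {n} → (Fin n → Bool) → Fin n → Fin n → Bool
(P ∖ a) x = not (does (x ≟ a)) ∧ P x

_∪_ _∩_ : ∀ {n} → (Fin n → Bool) → (Fin n → Bool) → Fin n → Bool
(P ∪ Q) x = P x ∨ Q x
(P ∩ Q) x = P x ∧ Q x

∖-≢ : ∀ {n} (P : Fin n → Bool) {a x : Fin n} → (P ∖ a) x ≡ true → x ≢ a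
∖-≢ P {a} {x} x∈P∖a with x ≟ a
∖-≢ P {a} {x} ()    | yes _
∖-≢ P {a} {x} x∈P∖a | no x≢a = x≢a

∖-⊆ : ∀ {n} (P : Fin n → Bool) {a x : Fin n} → (P ∖ a) x ≡ true → P x ≡ true
∖-⊆ P = Bool.∧-conicalʳ _ _

∖-intro : ∀ {n} (P : Fin n → Bool) {a x : Fin n} → x ≢ a → P x ≡ true → (P ∖ a) x ≡ true
∖-intro P {a} {x} x≢a Px rewrite dec-false (x ≟ a) x≢a = Px

∖-sym : ∀ {n} (R : Fin n → Fin n → Bool) → (∀ x y → R x y ≡ R y x) →
        ∀ {x y} → (R x ∖ x) y ≡ true → (R y ∖ y) x ≡ true
∖-sym R R-sym {x} {y} y∈Rx =
  ∖-intro (R y) (λ x≡y → ∖-≢ (R x) y∈Rx (sym x≡y)) (trans (R-sym y x) (∖-⊆ (R x) y∈Rx))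

sum-mono : ∀ {n} {f g : Fin n → ℕ} → (∀ i → f i ≤ g i) → sum f ≤ sum g
sum-mono {zero}  f≤g = z≤n
sum-mono {suc n} f≤g = +-mono-≤ (f≤g zero) (sum-mono (f≤g ∘ suc))

count-cong : ∀ {n} {P Q : Fin n → Bool} → (∀ x → P x ≡ Q x) → count P ≡ count Q
count-cong P≗Q = sum-cong-≗ (cong ⟦_⟧ ∘ P≗Q)

count-mono : ∀ {n} {P Q : Fin n → Bool} → (∀ x → P x ≡ true → Q x ≡ true) → count P ≤ count Q
count-mono P⊆Q = sum-mono (λ x → ⟦⟧-mono (P⊆Q x))
  where
  ⟦⟧-mono : ∀ {a b} → (a ≡ true → b ≡ true) → ⟦ a ⟧ ≤ ⟦ b ⟧
  ⟦⟧-mono {false}     _   = z≤n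
  ⟦⟧-mono {true}  {b} a⇒b rewrite a⇒b refl = ≤-refl

count-∪ : ∀ {n} (P Q : Fin n → Bool) → count (P ∪ Q) ≤ count P + count Q
count-∪ P Q = ≤-trans (sum-mono (λ x → ⟦∨⟧ (P x) (Q x))) (≤-reflexive (∑-distrib-+ (λ x → ⟦ P x ⟧) (λ x → ⟦ Q x ⟧)))
  where
  ⟦∨⟧ : ∀ a b → ⟦ a ∨ b ⟧ ≤ ⟦ a ⟧ + ⟦ b ⟧
  ⟦∨⟧ true  _ = s≤s z≤n
  ⟦∨⟧ false _ = ≤-refl

count-all : ∀ n → count {n} (λ _ → true) ≡ n
count-all zero    = refl
count-all (suc n) = cong suc (count-all n)

count-split : ∀ {n} (P : Fin n → Bool) (a : Fin n) → count P ≡ ⟦ P a ⟧ + count (P ∖ a)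
count-split P zero    = refl
count-split P (suc a) = begin
  ⟦ P zero ⟧ + count (P ∘ suc)                          ≡⟨ cong (⟦ P zero ⟧ +_) (count-split (P ∘ suc) a) ⟩
  ⟦ P zero ⟧ + (⟦ P (suc a) ⟧ + count (P ∘ suc ∖ a))    ≡⟨ x∙yz≈y∙xz ⟦ P zero ⟧ ⟦ P (suc a) ⟧ _ ⟩
  ⟦ P (suc a) ⟧ + (⟦ P zero ⟧ + count (P ∘ suc ∖ a))    ∎
  where open ≡-Reasoning

count-remove : ∀ {n} (P : Fin n → Bool) {a} → P a ≡ true → count P ≡ suc (count (P ∖ a))
count-remove P {a} Pa = trans (count-split P a) (cong (λ b → ⟦ b ⟧ + count (P ∖ a)) Pa)

count-remove-absent : ∀ {n} (P : Fin n → Bool) {a} → P a ≡ false → count (P ∖ a) ≡ count P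
count-remove-absent P {a} ¬Pa = sym (trans (count-split P a) (cong (λ b → ⟦ b ⟧ + count (P ∖ a)) ¬Pa))

count-find : ∀ {n} {P : Fin n → Bool} → 0 < count P → ∃ λ x → P x ≡ true
count-find {suc n} {P} pos with P zero in P0
... | true  = zero , P0
... | false = let x , Px = count-find {P = P ∘ suc} pos in suc x , Px

sum-≥ : ∀ {n} (P : Fin n → Bool) (f : Fin n → ℕ) k →
        (∀ i → P i ≡ true → k ≤ f i) → count P * k ≤ sum f
sum-≥ {zero}  P f k big = z≤n
sum-≥ {suc n} P f k big with P zero in P0
... | true  = +-mono-≤ (big zero P0) (sum-≥ (P ∘ suc) (f ∘ suc) k (big ∘ suc))
... | false = ≤-trans (sum-≥ (P ∘ suc) (f ∘ suc) k (big ∘ suc)) (m≤n+m _ (f zero))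

sum-≤ : ∀ {n} (P : Fin n → Bool) (f : Fin n → ℕ) k →
        (∀ i → P i ≡ true → f i ≤ k) → (∀ i → P i ≡ false → f i ≡ 0) → sum f ≤ count P * k
sum-≤ {zero}  P f k small vanish = z≤n
sum-≤ {suc n} P f k small vanish with P zero in P0
... | true  = +-mono-≤ (small zero P0) (sum-≤ (P ∘ suc) (f ∘ suc) k (small ∘ suc) (vanish ∘ suc))
... | false rewrite vanish zero P0 = sum-≤ (P ∘ suc) (f ∘ suc) k (small ∘ suc) (vanish ∘ suc)

∷-injective : ∀ {k n} {a : Fin n} {g : Fin k → Fin n} →
              (∀ i → g i ≢ a) → Injective _≡_ _≡_ g → Injective _≡_ _≡_ (a ∷ g)
∷-injective fresh inj {zero}  {zero}  _     = refl
∷-injective fresh inj {zero}  {suc j} a≡gj  = ⊥-elim (fresh j (sym a≡gj))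
∷-injective fresh inj {suc i} {zero}  gi≡a  = ⊥-elim (fresh i gi≡a)
∷-injective fresh inj {suc i} {suc j} gi≡gj = cong suc (inj gi≡gj)

↑-cases : ∀ {p q} {Q : Fin (p + q) → Set} →
          (∀ i → Q (i ↑ˡ q)) → (∀ j → Q (p ↑ʳ j)) → ∀ k → Q k
↑-cases {p} {q} {Q} left right k = subst Q (join-splitAt p q k) (by-block (splitAt p k))
  where
  by-block : ∀ s → Q (join p q s)
  by-block (inj₁ i) = left i
  by-block (inj₂ j) = right j

Choice : ∀ {n} → ℕ → (P : Fin n → Bool) → Set
Choice {n} k P = Σ (Fin k → Fin n) λ g → Injective _≡_ _≡_ g × (∀ i → P (g i) ≡ true)

select : ∀ {n} k (P : Fin n → Bool) → k ≤ count P → Choice k P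
select zero    P _ = (λ ()) , (λ { {()} }) , (λ ())
select (suc k) P k<|P| = extend (count-find (≤-trans (s≤s z≤n) k<|P|))
  where
  extend : (∃ λ a → P a ≡ true) → Choice (suc k) P
  extend (a , Pa) =
    let g , g-inj , g∈P∖a = select k (P ∖ a) (≤-pred (subst (suc k ≤_) (count-remove P Pa) k<|P|))
    in  a ∷ g , ∷-injective (λ i → ∖-≢ P (g∈P∖a i)) g-inj
              , λ { zero → Pa ; (suc i) → ∖-⊆ P (g∈P∖a i) }

DisjointChoice : ∀ {n} → ℕ → ℕ → (A B : Fin n → Bool) → Set
DisjointChoice {n} p q A B =
  Σ (Fin (p + q) → Fin n) λ g → Injective _≡_ _≡_ g ×
    (∀ i → A (g (i ↑ˡ q)) ≡ true) × (∀ j → B (g (p ↑ʳ j)) ≡ true)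

-- Under the hypotheses of selectDisjoint with p ≥ 1, some a ∈ A can be chosen
-- while keeping q elements of B ∖ a: take a ∈ A ∖ B if there is one;
-- otherwise A ⊆ B, so |B| = |A ∪ B| > p + q.
pivot : ∀ {n} p q (A B : Fin n → Bool) → 0 < count A → q ≤ count B → suc p + q ≤ count (A ∪ B) →
        ∃ λ a → A a ≡ true × q ≤ count (B ∖ a)
pivot p q A B A≠∅ q≤|B| |A∪B| with any? (λ x → A x ∧ not (B x) Bool.≟ true)
... | yes (a , a∈A∖B) =
  a , Bool.∧-conicalˡ _ _ a∈A∖B
    , subst (q ≤_) (sym (count-remove-absent B (Bool.not-injective (Bool.∧-conicalʳ (A a) _ a∈A∖B)))) q≤|B|
... | no A⊈B =
  let a , Aa = count-find A≠∅ in
  a , Aa , ≤-trans (m≤n+m q p) (≤-pred (subst (suc p + q ≤_) (count-remove B (A⊆B a Aa)) (≤-trans |A∪B| (count-mono A∪B⊆B))))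
  where
  A⊆B : ∀ x → A x ≡ true → B x ≡ true
  A⊆B x Ax with B x in Bx
  ... | true  = refl
  ... | false = ⊥-elim (A⊈B (x , cong₂ (λ u v → u ∧ not v) Ax Bx))
  A∪B⊆B : ∀ x → (A ∪ B) x ≡ true → B x ≡ true
  A∪B⊆B x x∈A∪B with A x in Ax
  ... | true  = A⊆B x Ax
  ... | false = x∈A∪B

selectDisjoint : ∀ {n} p q (A B : Fin n → Bool) →
                 p ≤ count A → q ≤ count B → p + q ≤ count (A ∪ B) → DisjointChoice p q A B
selectDisjoint zero q A B _ q≤|B| _ =
  let g , g-inj , g∈B = select q B q≤|B| in g , g-inj , (λ ()) , g∈B
selectDisjoint (suc p) q A B p<|A| q≤|B| |A∪B| =
  extend (pivot p q A B (≤-trans (s≤s z≤n) p<|A|) q≤|B| |A∪B|)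
  where
  extend : (∃ λ a → A a ≡ true × q ≤ count (B ∖ a)) → DisjointChoice (suc p) q A B
  extend (a , Aa , q≤|B∖a|) = prepend (selectDisjoint p q (A ∖ a) (B ∖ a) p≤|A∖a| q≤|B∖a| |A∖a∪B∖a|)
    where
    p≤|A∖a| : p ≤ count (A ∖ a)
    p≤|A∖a| = ≤-pred (subst (suc p ≤_) (count-remove A Aa) p<|A|)
    |A∖a∪B∖a| : p + q ≤ count (A ∖ a ∪ B ∖ a)
    |A∖a∪B∖a| =
      subst (p + q ≤_) (count-cong (λ x → Bool.∧-distribˡ-∨ _ (A x) (B x)))
        (≤-pred (subst (suc p + q ≤_) (count-remove (A ∪ B) (cong (_∨ B a) Aa)) |A∪B|))
    prepend : DisjointChoice p q (A ∖ a) (B ∖ a) → DisjointChoice (suc p) q A B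
    prepend (g , g-inj , g∈A∖a , g∈B∖a) =
      a ∷ g , ∷-injective (↑-cases (λ i → ∖-≢ A (g∈A∖a i)) (λ j → ∖-≢ B (g∈B∖a j))) g-inj
            , (λ { zero → Aa ; (suc i) → ∖-⊆ A (g∈A∖a i) }) , (λ j → ∖-⊆ B (g∈B∖a j))

-- The edge list of B₄,₄: B44 is fromEdges 8 bistarEdges by definition.
bistarEdges : List (ℕ × ℕ)
bistarEdges = (0 , 1) ∷ᴸ (0 , 2) ∷ᴸ (0 , 3) ∷ᴸ (0 , 4) ∷ᴸ (1 , 5) ∷ᴸ (1 , 6) ∷ᴸ (1 , 7) ∷ᴸ []

module Neighbourhoods {N : ℕ} (c : Colouring N) where

  red blue : Fin N → Fin N → Bool
  red  x = c x ∖ x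
  blue x = not ∘ c x ∖ x

  red-≢ : ∀ {x y} → red x y ≡ true → y ≢ x
  red-≢ {x} = ∖-≢ (c x)

  red-colour : ∀ {x y} → red x y ≡ true → c x y ≡ true
  red-colour {x} = ∖-⊆ (c x)

  blue-≢ : ∀ {x y} → blue x y ≡ true → y ≢ x
  blue-≢ {x} = ∖-≢ (not ∘ c x)

  blue-colour : ∀ {x y} → blue x y ≡ true → c x y ≡ false
  blue-colour {x} y∈blue = Bool.not-injective {y = false} (∖-⊆ (not ∘ c x) y∈blue)

  red-sym : Symmetric c → ∀ {x y} → red x y ≡ true → red y x ≡ true
  red-sym sy = ∖-sym c sy

  blue-sym : Symmetric c → ∀ {x y} → blue x y ≡ true → blue y x ≡ true
  blue-sym sy = ∖-sym (λ x → not ∘ c x) (λ x y → cong not (sy x y))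

  -- Every vertex other than x is a red or a blue neighbour of x.
  degrees : ∀ x → N ≤ suc (count (red x) + count (blue x))
  degrees x = begin
    N                                          ≡⟨ count-all N ⟨
    count {N} (λ _ → true)                     ≡⟨ count-remove (λ _ → true) {x} refl ⟩
    suc (count ((λ _ → true) ∖ x))             ≤⟨ s≤s (count-mono others⊆) ⟩
    suc (count (red x ∪ blue x))               ≤⟨ s≤s (count-∪ (red x) (blue x)) ⟩
    suc (count (red x) + count (blue x))       ∎
    where
    open ≤-Reasoning
    others⊆ : ∀ y → ((λ _ → true) ∖ x) y ≡ true → (red x ∪ blue x) y ≡ true
    others⊆ y y≢x with does (y ≟ x) | c x y
    ... | false | true  = refl
    ... | false | false = refl
    ... | true  | _     = ⊥-elim (Bool.not-¬ refl (sym y≢x))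

  blueStar : Symmetric c → ∀ {k} x (g : Fin k → Fin N) → Injective _≡_ _≡_ g →
             (∀ i → blue x (g i) ≡ true) → HasCopy c false (Star k)
  blueStar sy x g g-inj g∈blue = x ∷ g , ∷-injective (λ i → blue-≢ (g∈blue i)) g-inj , adj
    where
    leaf : ∀ j → toℕ j ≢ 0 → c x ((x ∷ g) j) ≡ false
    leaf zero    j≢0 = ⊥-elim (j≢0 refl)
    leaf (suc j) _   = blue-colour (g∈blue j)
    adj : ∀ i j → Adj (Star _) i j → c ((x ∷ g) i) ((x ∷ g) j) ≡ false
    adj zero    j       (inj₁ (_ , j≢0)) = leaf j j≢0
    adj (suc _) _       (inj₁ (() , _))
    adj i       zero    (inj₂ (_ , i≢0)) = trans (sy _ _) (leaf i i≢0)
    adj _       (suc _) (inj₂ (() , _))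

  noBlueStar : ∀ {d} (nbr : Fin N → Fin d → Fin N) → (∀ x y → c x y ≡ false → ∃ λ k → y ≡ nbr x k) →
               ¬ HasCopy c false (Star (suc d))
  noBlueStar nbr covered (f , f-inj , adj) = 1+n≰n (injective⇒≤ index-injective)
    where
    leafCovered : ∀ i → ∃ λ k → f (suc i) ≡ nbr (f zero) k
    leafCovered i = covered _ _ (adj zero (suc i) (inj₁ (refl , λ ())))
    index : Fin _ → Fin _
    index i = proj₁ (leafCovered i)
    index-injective : Injective _≡_ _≡_ index
    index-injective {i} {j} same = suc-injective (f-inj (begin
      f (suc i)              ≡⟨ proj₂ (leafCovered i) ⟩
      nbr (f zero) (index i) ≡⟨ cong (nbr (f zero)) same ⟩
      nbr (f zero) (index j) ≡⟨ proj₂ (leafCovered j) ⟨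
      f (suc j)              ∎))
      where open ≡-Reasoning

  redBistar : Symmetric c → ∀ {a b} → red a b ≡ true → DisjointChoice 3 3 (red a ∖ b) (red b ∖ a) →
              HasCopy c true B44
  redBistar sy {a} {b} b∈red-a (g , g-inj , g∈A , g∈B) = f , f-inj , adj
    where
    f : Fin 8 → Fin N
    f = a ∷ b ∷ g
    f-inj : Injective _≡_ _≡_ f
    f-inj = ∷-injective (λ { zero → red-≢ b∈red-a ; (suc k) → ≢a k })
                        (∷-injective (↑-cases (λ i → ∖-≢ (red a) (g∈A i)) (λ j → red-≢ (∖-⊆ (red b) (g∈B j)))) g-inj)
      where
      ≢a : ∀ k → g k ≢ a
      ≢a = ↑-cases (λ i → red-≢ (∖-⊆ (red a) (g∈A i))) (λ j → ∖-≢ (red b) (g∈B j))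
    fromA : ∀ i → c a (g (i ↑ˡ 3)) ≡ true
    fromA i = red-colour (∖-⊆ (red a) (g∈A i))
    fromB : ∀ j → c b (g (3 ↑ʳ j)) ≡ true
    fromB j = red-colour (∖-⊆ (red b) (g∈B j))
    along : ∀ {i j} k l → (toℕ i , toℕ j) ≡ (toℕ k , toℕ l) → c (f k) (f l) ≡ true → c (f i) (f j) ≡ true
    along k l same kl rewrite toℕ-injective (cong proj₁ same) | toℕ-injective (cong proj₂ same) = kl
    listed : ∀ i j → (toℕ i , toℕ j) ∈ bistarEdges → c (f i) (f j) ≡ true
    listed i j (here e)                                             = along 0F 1F e (red-colour b∈red-a)
    listed i j (there (here e))                                     = along 0F 2F e (fromA 0F)
    listed i j (there (there (here e)))                             = along 0F 3F e (fromA 1F)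
    listed i j (there (there (there (here e))))                     = along 0F 4F e (fromA 2F)
    listed i j (there (there (there (there (here e)))))             = along 1F 5F e (fromB 0F)
    listed i j (there (there (there (there (there (here e))))))     = along 1F 6F e (fromB 1F)
    listed i j (there (there (there (there (there (there (here e))))))) = along 1F 7F e (fromB 2F)
    adj : ∀ i j → Adj B44 i j → c (f i) (f j) ≡ true
    adj i j (inj₁ ij) = listed i j ij
    adj i j (inj₂ ji) = trans (sy _ _) (listed j i ji)

  bistarDominated : Symmetric c → ((f , _ , _) : HasCopy c true B44) →
                    ∀ i → c (f 0F) (f i) ≡ true ⊎ c (f 1F) (f i) ≡ true
  bistarDominated sy (f , _ , adj) 0F = inj₂ (trans (sy _ _) (adj 0F 1F (inj₁ (here refl))))
  bistarDominated sy (f , _ , adj) 1F = inj₁ (adj 0F 1F (inj₁ (here refl)))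
  bistarDominated sy (f , _ , adj) 2F = inj₁ (adj 0F 2F (inj₁ (there (here refl))))
  bistarDominated sy (f , _ , adj) 3F = inj₁ (adj 0F 3F (inj₁ (there (there (here refl)))))
  bistarDominated sy (f , _ , adj) 4F = inj₁ (adj 0F 4F (inj₁ (there (there (there (here refl))))))
  bistarDominated sy (f , _ , adj) 5F = inj₂ (adj 1F 5F (inj₁ (there (there (there (there (here refl)))))))
  bistarDominated sy (f , _ , adj) 6F = inj₂ (adj 1F 6F (inj₁ (there (there (there (there (there (here refl))))))))
  bistarDominated sy (f , _ , adj) 7F = inj₂ (adj 1F 7F (inj₁ (there (there (there (there (there (there (here refl)))))))))

open Neighbourhoods

module Sparse (c : Colouring 9) (sy : Symmetric c) (sparse : ∀ x → count (blue c x) ≤ 3) where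

  -- Each vertex has at least 8 - 3 red neighbours.
  redDegree : ∀ x → 5 ≤ count (red c x)
  redDegree x = +-cancelʳ-≤ 3 5 (count (red c x)) (≤-trans (≤-pred (degrees c x)) (+-monoʳ-≤ (count (red c x)) (sparse x)))

  pairs : Fin 9 → Fin 9 → Bool
  pairs v w = red c 0F v ∧ (blue c 0F ∩ blue c v) w

  -- A blue neighbour w of 0 is paired with at most 2 vertices v, all in blue(w) ∖ 0.
  pairsAt : ∀ w → blue c 0F w ≡ true → count (λ v → pairs v w) ≤ 2
  pairsAt w w∈blue0 = ≤-pred (≤-trans (s≤s (count-mono paired⊆)) (≤-trans (≤-reflexive |blue-w|) (sparse w)))
    where
    |blue-w| : suc (count (blue c w ∖ 0F)) ≡ count (blue c w)
    |blue-w| = sym (count-remove (blue c w) (blue-sym c sy w∈blue0))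
    paired⊆ : ∀ v → pairs v w ≡ true → (blue c w ∖ 0F) v ≡ true
    paired⊆ v vw = ∖-intro (blue c w) (∖-≢ (c 0F) v∈red0) (blue-sym c sy w∈blue-v)
      where
      v∈red0 : red c 0F v ≡ true
      v∈red0 = Bool.∧-conicalˡ (red c 0F v) _ vw
      w∈blue-v : blue c v w ≡ true
      w∈blue-v = Bool.∧-conicalʳ (blue c 0F w) _ (Bool.∧-conicalʳ (red c 0F v) _ vw)

  fewCommon : ∃ λ v → red c 0F v ≡ true × count (blue c 0F ∩ blue c v) ≤ 1
  fewCommon with any? (λ v → (red c 0F v Bool.≟ true) ×-dec (count (blue c 0F ∩ blue c v) ≤? 1))
  ... | yes found = found
  ... | no  none  = ⊥-elim (<⇒≱ (s≤s (s≤s (s≤s (s≤s (s≤s (s≤s (s≤s z≤n))))))) (begin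
    10                                          ≤⟨ *-monoˡ-≤ 2 (redDegree 0F) ⟩
    count (red c 0F) * 2                        ≤⟨ sum-≥ (red c 0F) _ 2 manyCommon ⟩
    sum (λ v → count (pairs v))                 ≡⟨ ∑-comm (λ v w → ⟦ pairs v w ⟧) ⟩
    sum (λ w → count (λ v → pairs v w))         ≤⟨ sum-≤ (blue c 0F) _ 2 pairsAt noPairs ⟩
    count (blue c 0F) * 2                       ≤⟨ *-monoˡ-≤ 2 (sparse 0F) ⟩
    6                                           ∎))
    where
    open ≤-Reasoning
    manyCommon : ∀ v → red c 0F v ≡ true → 2 ≤ count (pairs v)
    manyCommon v v∈red0 rewrite v∈red0 = ≰⇒> (λ few → none (v , v∈red0 , few))
    noPairs : ∀ w → blue c 0F w ≡ false → count (λ v → pairs v w) ≡ 0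
    noPairs w w∉blue0 = n≤0⇒n≡0 (count-mono {P = λ v → pairs v w} {Q = λ _ → false} (λ v vw →
      trans (sym w∉blue0) (Bool.∧-conicalˡ (blue c 0F w) _ (Bool.∧-conicalʳ (red c 0F v) _ vw))))

  covered : ∀ v w → ((λ _ → true) ∖ 0F ∖ v) w ≡ true →
            ((red c 0F ∖ v ∪ red c v ∖ 0F) ∪ (blue c 0F ∩ blue c v)) w ≡ true
  covered v w other with does (w ≟ 0F) | does (w ≟ v) | c 0F w | c v w
  ... | false | false | true  | _     = refl
  ... | false | false | false | true  = refl
  ... | false | false | false | false = refl
  ... | true  | true  | _     | _     = ⊥-elim (Bool.not-¬ refl (sym other))
  ... | true  | false | _     | _     = ⊥-elim (Bool.not-¬ refl (sym other))
  ... | false | true  | _     | _     = ⊥-elim (Bool.not-¬ refl (sym other))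

  redBistarAt : ∀ {v} → red c 0F v ≡ true → count (blue c 0F ∩ blue c v) ≤ 1 → HasCopy c true B44
  redBistarAt {v} v∈red0 few = redBistar c sy v∈red0 (selectDisjoint 3 3 A B 3≤|A| 3≤|B| 6≤|A∪B|)
    where
    A B : Fin 9 → Bool
    A = red c 0F ∖ v
    B = red c v ∖ 0F
    0∈red-v : red c v 0F ≡ true
    0∈red-v = red-sym c sy v∈red0
    3≤|A| : 3 ≤ count A
    3≤|A| = ≤-pred (≤-trans (m≤n+m 4 1) (subst (5 ≤_) (count-remove (red c 0F) v∈red0) (redDegree 0F)))
    3≤|B| : 3 ≤ count B
    3≤|B| = ≤-pred (≤-trans (m≤n+m 4 1) (subst (5 ≤_) (count-remove (red c v) 0∈red-v) (redDegree v)))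
    |others| : 7 ≡ count ((λ _ → true) ∖ 0F ∖ v)
    |others| = Data.Nat.Properties.suc-injective (count-remove ((λ _ → true) ∖ 0F) {v} (∖-intro (λ _ → true) (∖-≢ (c 0F) v∈red0) refl))
    6≤|A∪B| : 6 ≤ count (A ∪ B)
    6≤|A∪B| = +-cancelʳ-≤ 1 6 _ (begin
      7                                             ≡⟨ |others| ⟩
      count ((λ _ → true) ∖ 0F ∖ v)                 ≤⟨ count-mono (covered v) ⟩
      count ((A ∪ B) ∪ (blue c 0F ∩ blue c v))      ≤⟨ count-∪ (A ∪ B) (blue c 0F ∩ blue c v) ⟩
      count (A ∪ B) + count (blue c 0F ∩ blue c v)  ≤⟨ +-monoʳ-≤ _ few ⟩
      count (A ∪ B) + 1                             ∎)
      where open ≤-Reasoning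

upperBound : Arrows 9 B44 (Star 4)
upperBound c sy with any? (λ x → 4 ≤? count (blue c x))
... | yes (x , 4≤|blue-x|) =
  let g , g-inj , g∈blue = select 4 (blue c x) 4≤|blue-x| in inj₂ (blueStar c sy x g g-inj g∈blue)
... | no  no-big =
  let v , v∈red0 , few = Sparse.fewCommon c sy sparse in inj₁ (Sparse.redBistarAt c sy sparse v∈red0 few)
  where
  sparse : ∀ x → count (blue c x) ≤ 3
  sparse x = ≤-pred (≰⇒> (λ big → no-big (x , big)))

_⊕_ : Fin 8 → ℕ → Fin 8
x ⊕ d = fromℕ< (m%n<n (toℕ x + d) 8)

wagnerNbr : Fin 8 → Fin 3 → Fin 8
wagnerNbr x 0F = x ⊕ 1
wagnerNbr x 1F = x ⊕ 7
wagnerNbr x 2F = x ⊕ 4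

wagner : Colouring 8
wagner x y = not (does (any? λ k → y ≟ wagnerNbr x k))

-- The following three facts are checked by evaluation on all vertices.
wagner-symmetric : Symmetric wagner
wagner-symmetric = from-yes (all? λ x → all? λ y → wagner x y Bool.≟ wagner y x)

wagner-covered : ∀ x y → wagner x y ≡ false → ∃ λ k → y ≡ wagnerNbr x k
wagner-covered = from-yes (all? λ x → all? λ y → (wagner x y Bool.≟ false) →-dec any? (λ k → y ≟ wagnerNbr x k))

wagner-common : ∀ a b → a ≢ b → wagner a b ≡ true → ∃ λ z → wagner a z ≡ false × wagner b z ≡ false
wagner-common = from-yes (all? λ a → all? λ b → ¬? (a ≟ b) →-dec (wagner a b Bool.≟ true) →-dec
                  any? (λ z → (wagner a z Bool.≟ false) ×-dec (wagner b z Bool.≟ false)))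

-- In a colouring of K₈ where any two red-adjacent vertices have a common blue
-- neighbour there is no red B₄,₄: that neighbour of its centres would have to
-- be one of its 8 vertices, all of which are red to a centre.
noRedBistar : (c : Colouring 8) → Symmetric c →
              (∀ a b → a ≢ b → c a b ≡ true → ∃ λ z → c a z ≡ false × c b z ≡ false) →
              ¬ HasCopy c true B44
noRedBistar c sy common copy@(f , f-inj , adj) = 1+n≰n (injective⇒≤ h-inj)
  where
  centresBlue : ∃ λ z → c (f 0F) z ≡ false × c (f 1F) z ≡ false
  centresBlue = common (f 0F) (f 1F) (λ same → 0≢1 (f-inj same)) (adj 0F 1F (inj₁ (here refl)))
    where
    0≢1 : 0F ≢ 1F
    0≢1 ()
  z : Fin 8
  z = proj₁ centresBlue
  -- z is blue to both centres, while every vertex of the copy is red to one of them.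
  z∉f : ∀ i → z ≢ f i
  z∉f i z≡fi = [ clash (proj₁ (proj₂ centresBlue)) , clash (proj₂ (proj₂ centresBlue)) ] (bistarDominated c sy copy i)
    where
    clash : ∀ {x} → c x z ≡ false → c x (f i) ≡ true → ⊥
    clash x-z-blue x-fi-red = Bool.not-¬ x-fi-red (trans (cong (c _) (sym z≡fi)) x-z-blue)
  h : Fin 8 → Fin 7
  h i = punchOut (z∉f i)
  h-inj : Injective _≡_ _≡_ h
  h-inj same = f-inj (punchOut-injective (z∉f _) (z∉f _) same)

lowerBound : ∀ M → M < 9 → ¬ Arrows M B44 (Star 4)
lowerBound M M<9 arrows with m≤n⇒m<n∨m≡n (≤-pred M<9)
... | inj₂ refl = [ noRedBistar wagner wagner-symmetric wagner-common
                  , noBlueStar wagner wagnerNbr wagner-covered ] (arrows wagner wagner-symmetric)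
... | inj₁ M<8  = [ tooFewVertices , noBlueEdge ] (arrows (λ _ _ → true) (λ _ _ → refl))
  where
  tooFewVertices : ¬ HasCopy {M} (λ _ _ → true) true B44
  tooFewVertices (f , f-inj , _) = <⇒≱ M<8 (injective⇒≤ f-inj)
  noBlueEdge : ¬ HasCopy {M} (λ _ _ → true) false (Star 4)
  noBlueEdge (_ , _ , adj) with adj 0F 1F (inj₁ (refl , λ ()))
  ... | ()

theorem6 : IsRamseyNumber B44 (Star 4) 9
theorem6 = upperBound , lowerBound
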